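{- For any finite graph $G$, $\sigma(G) \leq |V(G)| - \alpha(G)$, where $\alpha(G)$ is the independence number of $G$.
   Context: Surrounding Cops and Robbers on a finite simple graph $G$ with $k \geq 1$ cops and one robber: the cops first choose starting vertices (several cops may share a vertex), then the robber chooses a starting vertex not occupied by a cop, and thereafter the cops and the robber alternate moves, the cops moving first. In a move, each player may move to an adjacent vertex or stay put; the robber may never move to, or remain on, a vertex occupied by a cop, so if a cop moves onto the robber's vertex the robber is compelled to move to a neighbouring vertex not occupied by a cop. The cops win if at any time every neighbour of the robber's vertex is occupied by a cop; the robber wins if he avoids this forever. Play is with perfect information. The surrounding cop number $\sigma(G)$ is the least number of cops for which the cops have a winning strategy. -}

module Defs where

open import Data.Nat using (ℕ; zero; suc; _<_; _≤_)
open import Data.Fin using (Fin)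
open import Data.Bool using (Bool; true; false)
open import Data.Vec using (Vec)
open import Data.Vec.Membership.Propositional using () renaming (_∈_ to _∈ᵥ_)
open import Data.Fin.Subset using (Subset; _∈_; ∣_∣)
open import Data.List using (List; []; _∷_; _++_)
open import Data.Product using (_×_; _,_; ∃; Σ)
open import Data.Sum using (_⊎_)
open import Relation.Nullary using (¬_)
open import Relation.Binary.PropositionalEquality using (_≡_)

record Graph (n : ℕ) : Set where
  field
    adj   : Fin n → Fin n → Bool
    sym   : ∀ u v → adj u v ≡ adj v u
    irrefl : ∀ v → adj v v ≡ false

open Graph public

Adj : ∀ {n} → Graph n → Fin n → Fin n → Set
Adj G u v = adj G u v ≡ true

HasEdge : ∀ {n} → Graph n → Set
HasEdge G = ∃ λ u → ∃ λ v → Adj G u v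

IsIndependent : ∀ {n} → Graph n → Subset n → Set
IsIndependent G S = ∀ u v → u ∈ S → v ∈ S → ¬ Adj G u v

IsIndependenceNumber : ∀ {n} → Graph n → ℕ → Set
IsIndependenceNumber {n} G a =
  (Σ (Subset n) λ S → IsIndependent G S × ∣ S ∣ ≡ a)
  × (∀ (S : Subset n) → IsIndependent G S → ∣ S ∣ ≤ a)

Config : ℕ → ℕ → Set
Config k n = Vec (Fin n) k

Occupied : ∀ {k n} → Config k n → Fin n → Set
Occupied c v = v ∈ᵥ c

Surrounded : ∀ {k n} → Graph n → Config k n → Fin n → Set
Surrounded G c r = ∀ v → Adj G r v → Occupied c v

Step : ∀ {n} → Graph n → Fin n → Fin n → Set
Step G u v = v ≡ u ⊎ Adj G u v

CopMoveLegal : ∀ {k n} → Graph n → Config k n → Config k n → Set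
CopMoveLegal G c c' = ∀ i → Step G (Data.Vec.lookup c i) (Data.Vec.lookup c' i)

RobberMoveLegal : ∀ {k n} → Graph n → Config k n → Fin n → Fin n → Set
RobberMoveLegal G c' r r' = Step G r r' × ¬ Occupied c' r'

-- A (deterministic, perfect-information, history-dependent) cop strategy:
-- starting configuration, and the next configuration as a function of the
-- full history [(C 0 , R 0) , … , (C t , R t)].
record CopStrategy (k n : ℕ) : Set where
  field
    start : Config k n
    next  : List (Config k n × Fin n) → Config k n

open CopStrategy public

-- Given a cop strategy S and the robber's positions R (R 0 = start,
-- R (t+1) = position after the robber's (t+1)-st move), the history
-- and cop positions of the resulting play.
history : ∀ {k n} → CopStrategy k n → (ℕ → Fin n) → ℕ → List (Config k n × Fin n)
history S R zero = (start S , R zero) ∷ []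
history S R (suc t) = history S R t ++ ((next S (history S R t) , R (suc t)) ∷ [])

copsAt : ∀ {k n} → CopStrategy k n → (ℕ → Fin n) → ℕ → Config k n
copsAt S R zero = start S
copsAt S R (suc t) = next S (history S R t)

-- The robber plays legally in the play against S: his start vertex is not
-- occupied, and whenever the game is not over (he is not surrounded after
-- the cops' move) his move is legal.
RobberLegal : ∀ {k n} → Graph n → CopStrategy k n → (ℕ → Fin n) → Set
RobberLegal G S R =
  ¬ Occupied (copsAt S R zero) (R zero)
  × (∀ t → ¬ Surrounded G (copsAt S R (suc t)) (R t)
         → RobberMoveLegal G (copsAt S R (suc t)) (R t) (R (suc t)))

-- The cops win the play: at some time the robber is surrounded (either after
-- the robber's t-th move / placement, or right after the cops' (t+1)-st move),
-- and all cop moves made up to that moment were legal.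
CopsWinPlay : ∀ {k n} → Graph n → CopStrategy k n → (ℕ → Fin n) → Set
CopsWinPlay G S R = ∃ λ t →
  (∀ s → s < t → CopMoveLegal G (copsAt S R s) (copsAt S R (suc s)))
  × ( Surrounded G (copsAt S R t) (R t)
    ⊎ (CopMoveLegal G (copsAt S R t) (copsAt S R (suc t))
       × Surrounded G (copsAt S R (suc t)) (R t)))

CopsWin : ∀ {n} → Graph n → ℕ → Set
CopsWin {n} G k = Σ (CopStrategy k n) λ S →
  ∀ (R : ℕ → Fin n) → RobberLegal G S R → CopsWinPlay G S R

-- σ(G) ≤ m  (σ(G) = least k ≥ 1 such that k cops win)
SurroundingCopNumber≤ : ∀ {n} → Graph n → ℕ → Set
SurroundingCopNumber≤ G m = ∃ λ k → 1 ≤ k × k ≤ m × CopsWin G k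

module Submission where

-- Let S be a maximum independent set of G, so |S| = α(G), and
-- station one cop on every vertex of the complement ∁ S, which is a vertex
-- cover of G.  The robber must start on an unoccupied vertex, i.e. in S,
-- and every neighbour of a vertex of S lies outside S (S is independent),
-- hence is occupied: the robber is surrounded the moment he is placed.
-- This uses |∁ S| = |V(G)| - α(G) cops, and at least one cop, because a
-- vertex cover of a graph with an edge is nonempty.

open import Defs
open import Data.Nat using (ℕ; _∸_; zero; suc; _≤_; z≤n; s≤s)
open import Data.Nat.Properties using (≤-reflexive)
open import Data.Fin using (Fin)
open import Data.Vec using (Vec; []; _∷_; map)
open import Data.Vec.Relation.Unary.Any using (here; there)
open import Data.Vec.Membership.Propositional.Properties using (∈-map⁺)
open import Data.Fin.Subset using (Subset; _∈_; ∣_∣; ∁; inside; outside)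
open import Data.Fin.Subset.Properties
  using (_∈?_; x∉p⇒x∈∁p; ∣∁p∣≡n∸∣p∣)
open import Data.Product using (_,_; proj₁)
open import Data.Sum using (_⊎_; inj₁; inj₂)
open import Data.Empty using (⊥-elim)
open import Relation.Nullary using (¬_; yes; no)
open import Relation.Binary.PropositionalEquality using (refl)

elements : ∀ {n} (p : Subset n) → Vec (Fin n) ∣ p ∣
elements []            = []
elements (inside  ∷ p) = Fin.zero ∷ map Fin.suc (elements p)
elements (outside ∷ p) = map Fin.suc (elements p)

elements-complete : ∀ {n} (p : Subset n) {x} → x ∈ p → Occupied (elements p) x
elements-complete (inside  ∷ p) Data.Vec.here         = here refl
elements-complete (inside  ∷ p) (Data.Vec.there x∈p) = there (∈-map⁺ Fin.suc (elements-complete p x∈p))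
elements-complete (outside ∷ p) (Data.Vec.there x∈p) = ∈-map⁺ Fin.suc (elements-complete p x∈p)

IsVertexCover : ∀ {k n} → Graph n → Config k n → Set
IsVertexCover G c = ∀ u v → Adj G u v → Occupied c u ⊎ Occupied c v

stationary : ∀ {k n} → Config k n → CopStrategy k n
stationary c = record { start = c ; next = λ _ → c }

cover-surrounds : ∀ {k n} (G : Graph n) (c : Config k n) → IsVertexCover G c →
                  ∀ r → ¬ Occupied c r → Surrounded G c r
cover-surrounds G c cover r r-free w rw with cover r w rw
... | inj₁ r-occ = ⊥-elim (r-free r-occ)
... | inj₂ w-occ = w-occ

-- k cops placed on a vertex cover win: the robber must start unoccupied,
-- and is then already surrounded at time 0.
vertex-cover-wins : ∀ {k n} (G : Graph n) (c : Config k n) → IsVertexCover G c → CopsWin G k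
vertex-cover-wins G c cover = stationary c , λ R legal →
  0 , (λ _ ()) , inj₁ (cover-surrounds G c cover (R 0) (proj₁ legal))

complement-covers : ∀ {n} (G : Graph n) (S : Subset n) → IsIndependent G S →
                    IsVertexCover G (elements (∁ S))
complement-covers G S ind u v uv with u ∈? S | v ∈? S
... | yes u∈S | yes v∈S = ⊥-elim (ind u v u∈S v∈S uv)
... | no  u∉S | _       = inj₁ (elements-complete (∁ S) (x∉p⇒x∈∁p u∉S))
... | yes _   | no  v∉S = inj₂ (elements-complete (∁ S) (x∉p⇒x∈∁p v∉S))

cover-of-edge⇒1≤k : ∀ {k n} (G : Graph n) (c : Config k n) → IsVertexCover G c →
                    HasEdge G → 1 ≤ k
cover-of-edge⇒1≤k {suc k} G c cover edge = s≤s z≤n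
cover-of-edge⇒1≤k {zero}  G [] cover (u , v , uv) with cover u v uv
... | inj₁ ()
... | inj₂ ()

lemma4 : ∀ (n : ℕ) (G : Graph n) (a : ℕ) → HasEdge G → IsIndependenceNumber G a
         → SurroundingCopNumber≤ G (n ∸ a)
lemma4 n G a edge ((S , ind , refl) , _) =
  ∣ ∁ S ∣ ,
  cover-of-edge⇒1≤k G cops cover edge ,
  ≤-reflexive (∣∁p∣≡n∸∣p∣ S) ,
  vertex-cover-wins G cops cover
  where
  cops : Config ∣ ∁ S ∣ n
  cops = elements (∁ S)

  cover : IsVertexCover G cops
  cover = complement-covers G S ind
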